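{- Let $K=\mathbb{Q}(\zeta_{21})$ with $\zeta_{21}=e^{2\pi i/21}$, $\zeta_{42}=-\zeta_{21}$, $\beta=\zeta_{21}^9-\zeta_{21}^7+\zeta_{21}^5+\zeta_{21}^2$ and $x_1=\beta^{ -3}\overline{\beta}^{\,3}\zeta_{42}^5$. Then for every positive integer $i$ there is a positive integer $c$ such that $7^c(x_1^i+x_1^{ -i})\in\mathcal{O}_K$ and $7^c(x_1^i+x_1^{ -i})\equiv 2\pmod{4\mathcal{O}_K}$; moreover, for every integer $n>c$, also $7^n(x_1^i+x_1^{ -i})\in\mathcal{O}_K$ and $7^n(x_1^i+x_1^{ -i})\equiv 2\pmod{4\mathcal{O}_K}$.
   Context: The bar denotes complex conjugation; $\mathcal{O}_K=\mathbb{Z}[\zeta_{21}]$. -}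

module Defs where

-- The cyclotomic field K = ℚ(ζ₂₁), realised as ℚ[x]/(Φ₂₁(x)) with the
-- power basis 1, ζ, …, ζ¹¹  (φ(21) = 12), where
--   Φ₂₁(x) = x¹² − x¹¹ + x⁹ − x⁸ + x⁶ − x⁴ + x³ − x + 1.
-- An element is its coordinate vector in this basis.
-- O_K = ℤ[ζ₂₁] = the elements with integer coordinates.

open import Data.Nat as ℕ using (ℕ; zero; suc)
open import Data.Integer as ℤ using (ℤ; +_; -[1+_]; +[1+_])
open import Data.Rational as ℚ using (ℚ; mkℚ; 0ℚ; 1ℚ; _/_)
open import Data.Vec as Vec using (Vec; []; _∷_; replicate; zipWith; map; head; foldr)
open import Data.List as List using (List)
open import Data.Product using (∃; ∃-syntax; _×_)
open import Relation.Binary.PropositionalEquality using (_≡_)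

K : Set
K = Vec ℚ 12

ι : ℚ → K
ι q = q ∷ replicate 11 0ℚ

0K 1K : K
0K = ι 0ℚ
1K = ι 1ℚ

infixl 6 _+K_ _-K_
infixl 7 _*K_ _·_
infixr 8 _^K_

_+K_ : K → K → K
_+K_ = zipWith ℚ._+_

-K_ : K → K
-K_ = map (λ q → ℚ.- q)

_-K_ : K → K → K
a -K b = a +K (-K b)

_·_ : ℚ → K → K
q · a = map (q ℚ.*_) a

-- ζ₂₁¹² = ζ¹¹ − ζ⁹ + ζ⁸ − ζ⁶ + ζ⁴ − ζ³ + ζ − 1
ζ¹² : K
ζ¹² = m1 ∷ 1ℚ ∷ 0ℚ ∷ m1 ∷ 1ℚ ∷ 0ℚ ∷ m1 ∷ 0ℚ ∷ 1ℚ ∷ m1 ∷ 0ℚ ∷ 1ℚ ∷ []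
  where
  m1 : ℚ
  m1 = ℚ.- 1ℚ


mulζ : K → K
mulζ a = (0ℚ ∷ Vec.init a) +K (Vec.last a · ζ¹²)

evalAt : K → K → K
evalAt a t = foldr (λ _ → K) (λ c acc → ι c +K t *' acc) 0K a
  where
  _*'_ : K → K → K
  u *' v = foldr (λ _ → K) (λ c acc → (c · v) +K mulζ acc) 0K u

_*K_ : K → K → K
a *K b = foldr (λ _ → K) (λ c acc → (c · b) +K mulζ acc) 0K a

_^K_ : K → ℕ → K
a ^K zero  = 1K
a ^K suc n = a *K (a ^K n)

ζ : K
ζ = 0ℚ ∷ 1ℚ ∷ replicate 10 0ℚ

σ : ℕ → K → K
σ a w = evalAt w (ζ ^K a)

-- complex conjugation = σ₋₁ = σ₂₀ (ζ ↦ ζ⁻¹ = ζ²⁰)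
conj : K → K
conj = σ 20

-- total reciprocal on ℚ (value at 0 is irrelevant; set to 0)
recip : ℚ → ℚ
recip (mkℚ (+ zero) _ _)       = 0ℚ
recip p@(mkℚ +[1+ n ] d c)     = ℚ.1/ p
recip p@(mkℚ -[1+ n ] d c)     = ℚ.1/ p

-- inverse in K via the norm: for w ≠ 0,
--   w⁻¹ = N(w)⁻¹ · ∏_{a ∈ (ℤ/21)ˣ, a ≠ 1} σ_a(w),   N(w) = ∏_{a ∈ (ℤ/21)ˣ} σ_a(w) ∈ ℚ.
otherUnits : List ℕ
otherUnits = 2 List.∷ 4 List.∷ 5 List.∷ 8 List.∷ 10 List.∷ 11 List.∷ 13 List.∷ 16 List.∷ 17 List.∷ 19 List.∷ 20 List.∷ List.[]

cofactor : K → K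
cofactor w = List.foldr (λ a acc → σ a w *K acc) 1K otherUnits

norm : K → ℚ
norm w = head (w *K cofactor w)

inv : K → K
inv w = recip (norm w) · cofactor w

ζ₄₂ : K
ζ₄₂ = -K ζ

β : K
β = (ζ ^K 9) -K (ζ ^K 7) +K (ζ ^K 5) +K (ζ ^K 2)

x₁ : K
x₁ = inv β ^K 3 *K conj β ^K 3 *K ζ₄₂ ^K 5

s : ℕ → K
s i = x₁ ^K i +K inv x₁ ^K i

toK : Vec ℤ 12 → K
toK = map (λ z → z / 1)

InOK : K → Set
InOK w = ∃[ v ] w ≡ toK v

Cong2mod4 : K → Set
Cong2mod4 w = ∃[ v ] w -K ι (+ 2 / 1) ≡ ι (+ 4 / 1) *K toK v

7^ : ℕ → ℚ
7^ n = + (7 ℕ.^ n) / 1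

-- Write a = 7x₁ and b = 7x₁⁻¹.  Evaluation shows that both have integer coordinates and that
-- a² ≡ b² ≡ 1 and a + b ≡ 2 (mod 4ℤ[ζ]).  Hence 7^(m+i) (x₁^i + x₁^-i) = 7^m (a^i + b^i) is
-- integral, a^i + b^i ≡ 2 (mod 4) by induction on i in steps of two, and as 7^m ≡ ±1 and
-- −2 ≡ 2 (mod 4), also 7^m (a^i + b^i) ≡ 2; so c = i works.
--
-- Congruences in ℤ[ζ] are checked coordinatewise: multiplication in the power basis is
-- polynomial in the coordinates, so every relation on coefficients that is closed under the
-- ring operations (the graph of ℤ → ℚ, congruence modulo n) is preserved by it.

module Submission where

open import Algebra.Bundles.Raw using (RawRing)
open import Algebra.Structures using (IsCommutativeRing)
open import Level using (0ℓ)
open import Data.Nat as ℕ using (ℕ; zero; suc; _≥_; _>_)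
import Data.Nat.Properties as ℕ
import Data.Nat.Coprimality as Coprime
open import Data.Integer as ℤ using (ℤ; +_; +[1+_]; -[1+_]; -1ℤ)
import Data.Integer.Properties as ℤ
open import Data.Integer.Divisibility.Signed
  using (_∣_; divides; _∣?_; ∣m∣n⇒∣m+n; ∣m⇒∣-m; ∣m⇒∣m*n; ∣n⇒∣m*n)
open import Data.Integer.Tactic.RingSolver using (solve-∀)
open import Data.Rational as ℚ using (ℚ; mkℚ; _/_)
import Data.Rational.Properties as ℚ
open import Data.Vec using (Vec; []; _∷_; replicate; zipWith; map; foldr; init; last)
open import Data.Vec.Properties
  using (≡-dec; map-∘; map-cong; map-id; map-const; map-replicate; zipWith-replicate₂)
open import Data.Vec.Relation.Binary.Pointwise.Inductive as Pointwise
  using (Pointwise; []; _∷_)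
open import Data.Product using (∃-syntax; _×_; _,_)
open import Data.Sum as Sum using (_⊎_; inj₁; inj₂)
open import Relation.Binary.Core using (REL)
open import Relation.Binary.PropositionalEquality
open import Relation.Nullary.Decidable using (Dec; from-yes)

open import Defs

init-map : ∀ {A B : Set} {n} (f : A → B) (u : Vec A (suc n)) →
           init (map f u) ≡ map f (init u)
init-map {n = zero}  f (x ∷ []) = refl
init-map {n = suc n} f (x ∷ u)  = cong (f x ∷_) (init-map f u)

last-map : ∀ {A B : Set} {n} (f : A → B) (u : Vec A (suc n)) → last (map f u) ≡ f (last u)
last-map {n = zero}  f (x ∷ []) = refl
last-map {n = suc n} f (x ∷ u)  = last-map f u

map-zipWith : ∀ {A : Set} {n} (f : A → A) (_∙_ : A → A → A) →
              (∀ x y → f (x ∙ y) ≡ f x ∙ f y) →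
              (u v : Vec A n) → map f (zipWith _∙_ u v) ≡ zipWith _∙_ (map f u) (map f v)
map-zipWith f _∙_ f-homo []      []      = refl
map-zipWith f _∙_ f-homo (x ∷ u) (y ∷ v) =
  cong₂ _∷_ (f-homo x y) (map-zipWith f _∙_ f-homo u v)

module _ {A B : Set} {_∼_ : REL A B 0ℓ} where

  zipWith⁺ : ∀ {n} {f : A → A → A} {g : B → B → B} →
             (∀ {x x′ y y′} → x ∼ x′ → y ∼ y′ → f x y ∼ g x′ y′) →
             ∀ {u v : Vec A n} {u′ v′ : Vec B n} →
             Pointwise _∼_ u u′ → Pointwise _∼_ v v′ →
             Pointwise _∼_ (zipWith f u v) (zipWith g u′ v′)
  zipWith⁺ f∼g []       []       = []
  zipWith⁺ f∼g (p ∷ ps) (q ∷ qs) = f∼g p q ∷ zipWith⁺ f∼g ps qs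

  replicate⁺ : ∀ n {x y} → x ∼ y → Pointwise _∼_ (replicate n x) (replicate n y)
  replicate⁺ zero    p = []
  replicate⁺ (suc n) p = p ∷ replicate⁺ n p

  init⁺ : ∀ {n} {u : Vec A (suc n)} {u′ : Vec B (suc n)} →
          Pointwise _∼_ u u′ → Pointwise _∼_ (init u) (init u′)
  init⁺ {zero}  (p ∷ []) = []
  init⁺ {suc n} (p ∷ ps) = p ∷ init⁺ ps

  last⁺ : ∀ {n} {u : Vec A (suc n)} {u′ : Vec B (suc n)} →
          Pointwise _∼_ u u′ → last u ∼ last u′
  last⁺ {zero}  (p ∷ []) = p
  last⁺ {suc n} (p ∷ ps) = last⁺ ps

-- R[ζ] = R[x]/(Φ₂₁) on coordinate vectors in the basis 1, ζ, …, ζ¹¹.  For R = ℚ these are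
-- definitionally the operations ι, _+K_, -K_, _·_, mulζ, _*K_ of Defs; only _^_ is a
-- separate recursion.
module Cyclotomic (R : RawRing 0ℓ 0ℓ) where
  open RawRing R

  Elt : Set
  Elt = Vec Carrier 12

  infixl 6 _⊕_ _⊖_
  infixl 7 _⊛_ _•_
  infixr 8 _^_

  ⟦_⟧ : Carrier → Elt
  ⟦ c ⟧ = c ∷ replicate 11 0#

  𝟘 𝟙 : Elt
  𝟘 = ⟦ 0# ⟧
  𝟙 = ⟦ 1# ⟧

  _⊕_ : Elt → Elt → Elt
  _⊕_ = zipWith _+_

  ⊖_ : Elt → Elt
  ⊖_ = map -_

  _⊖_ : Elt → Elt → Elt
  u ⊖ v = u ⊕ (⊖ v)

  _•_ : Carrier → Elt → Elt
  c • u = map (c *_) u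

  ζ¹²-coords : Elt
  ζ¹²-coords = m1 ∷ 1# ∷ 0# ∷ m1 ∷ 1# ∷ 0# ∷ m1 ∷ 0# ∷ 1# ∷ m1 ∷ 0# ∷ 1# ∷ []
    where
    m1 : Carrier
    m1 = - 1#

  timesζ : Elt → Elt
  timesζ u = (0# ∷ init u) ⊕ (last u • ζ¹²-coords)

  mulBy : ∀ {m} → Vec Carrier m → Elt → Elt
  mulBy a v = foldr (λ _ → Elt) (λ c acc → c • v ⊕ timesζ acc) 𝟘 a

  _⊛_ : Elt → Elt → Elt
  _⊛_ = mulBy

  _^_ : Elt → ℕ → Elt
  u ^ zero  = 𝟙
  u ^ suc n = u ⊛ u ^ n

  module Laws (isCommutativeRing : IsCommutativeRing _≡_ _+_ _*_ -_ 0# 1#) where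
    open IsCommutativeRing isCommutativeRing
      using (*-assoc; *-comm; *-identityˡ; +-identityʳ; zeroˡ; zeroʳ; distribˡ)
    open ≡-Reasoning

    •-assoc : ∀ c d u → c • (d • u) ≡ (c * d) • u
    •-assoc c d u =
      trans (sym (map-∘ (c *_) (d *_) u)) (map-cong (λ x → sym (*-assoc c d x)) u)

    •-identityˡ : ∀ u → 1# • u ≡ u
    •-identityˡ u = trans (map-cong *-identityˡ u) (map-id u)

    •-zeroˡ : ∀ u → 0# • u ≡ 𝟘
    •-zeroˡ u = trans (map-cong zeroˡ u) (map-const u 0#)

    •-zeroʳ : ∀ c → c • 𝟘 ≡ 𝟘
    •-zeroʳ c = trans (map-replicate (c *_) 0# 12) (cong (replicate 12) (zeroʳ c))

    •-distribˡ-⊕ : ∀ c u v → c • (u ⊕ v) ≡ c • u ⊕ c • v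
    •-distribˡ-⊕ c = map-zipWith (c *_) _+_ (distribˡ c)

    ⊕-identityʳ : ∀ u → u ⊕ 𝟘 ≡ u
    ⊕-identityʳ u =
      trans (zipWith-replicate₂ _+_ u 0#) (trans (map-cong +-identityʳ u) (map-id u))

    timesζ-• : ∀ c u → timesζ (c • u) ≡ c • timesζ u
    timesζ-• c u = begin
      (0# ∷ init (c • u)) ⊕ last (c • u) • ζ¹²-coords
        ≡⟨ cong₂ (λ a x → (0# ∷ a) ⊕ x • ζ¹²-coords) (init-map (c *_) u) (last-map (c *_) u) ⟩
      (0# ∷ map (c *_) (init u)) ⊕ (c * last u) • ζ¹²-coords
        ≡⟨ cong₂ (λ x y → (x ∷ map (c *_) (init u)) ⊕ y)
                 (zeroʳ c) (•-assoc c (last u) ζ¹²-coords) ⟨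
      c • (0# ∷ init u) ⊕ c • (last u • ζ¹²-coords)
        ≡⟨ •-distribˡ-⊕ c (0# ∷ init u) (last u • ζ¹²-coords) ⟨
      c • timesζ u ∎

    mulBy-•ˡ : ∀ {m} c (a : Vec Carrier m) v → mulBy (map (c *_) a) v ≡ c • mulBy a v
    mulBy-•ˡ c []      v = sym (•-zeroʳ c)
    mulBy-•ˡ c (x ∷ a) v = begin
      (c * x) • v ⊕ timesζ (mulBy (map (c *_) a) v)
        ≡⟨ cong₂ _⊕_ (sym (•-assoc c x v))
                     (trans (cong timesζ (mulBy-•ˡ c a v)) (timesζ-• c (mulBy a v))) ⟩
      c • (x • v) ⊕ c • timesζ (mulBy a v)
        ≡⟨ •-distribˡ-⊕ c (x • v) (timesζ (mulBy a v)) ⟨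
      c • (x • v ⊕ timesζ (mulBy a v)) ∎

    mulBy-•ʳ : ∀ {m} c (a : Vec Carrier m) v → mulBy a (c • v) ≡ c • mulBy a v
    mulBy-•ʳ c []      v = sym (•-zeroʳ c)
    mulBy-•ʳ c (x ∷ a) v = begin
      x • (c • v) ⊕ timesζ (mulBy a (c • v))
        ≡⟨ cong₂ _⊕_ x•c•v≡c•x•v
                     (trans (cong timesζ (mulBy-•ʳ c a v)) (timesζ-• c (mulBy a v))) ⟩
      c • (x • v) ⊕ c • timesζ (mulBy a v)
        ≡⟨ •-distribˡ-⊕ c (x • v) (timesζ (mulBy a v)) ⟨
      c • (x • v ⊕ timesζ (mulBy a v)) ∎
      where
      x•c•v≡c•x•v : x • (c • v) ≡ c • (x • v)
      x•c•v≡c•x•v =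
        trans (•-assoc x c v) (trans (cong (_• v) (*-comm x c)) (sym (•-assoc c x v)))

    •-⊛-• : ∀ c d u v → (c • u) ⊛ (d • v) ≡ (c * d) • (u ⊛ v)
    •-⊛-• c d u v = begin
      (c • u) ⊛ (d • v)   ≡⟨ mulBy-•ˡ c u (d • v) ⟩
      c • (u ⊛ (d • v))   ≡⟨ cong (c •_) (mulBy-•ʳ d u v) ⟩
      c • (d • (u ⊛ v))   ≡⟨ •-assoc c d (u ⊛ v) ⟩
      (c * d) • (u ⊛ v)   ∎

    timesζ-𝟘 : timesζ 𝟘 ≡ 𝟘
    timesζ-𝟘 = trans (cong (𝟘 ⊕_) (•-zeroˡ ζ¹²-coords)) (⊕-identityʳ 𝟘)

    mulBy-zeros : ∀ k u → mulBy (replicate k 0#) u ≡ 𝟘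
    mulBy-zeros zero    u = refl
    mulBy-zeros (suc k) u = begin
      0# • u ⊕ timesζ (mulBy (replicate k 0#) u)
        ≡⟨ cong₂ (λ a b → a ⊕ timesζ b) (•-zeroˡ u) (mulBy-zeros k u) ⟩
      𝟘 ⊕ timesζ 𝟘   ≡⟨ cong (𝟘 ⊕_) timesζ-𝟘 ⟩
      𝟘 ⊕ 𝟘          ≡⟨ ⊕-identityʳ 𝟘 ⟩
      𝟘              ∎

    ⟦⟧-⊛ : ∀ c u → ⟦ c ⟧ ⊛ u ≡ c • u
    ⟦⟧-⊛ c u = begin
      c • u ⊕ timesζ (mulBy (replicate 11 0#) u)
        ≡⟨ cong (λ w → c • u ⊕ timesζ w) (mulBy-zeros 11 u) ⟩
      c • u ⊕ timesζ 𝟘   ≡⟨ cong (c • u ⊕_) timesζ-𝟘 ⟩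
      c • u ⊕ 𝟘          ≡⟨ ⊕-identityʳ (c • u) ⟩
      c • u              ∎

-- A subring of R × S, seen as a relation.
record Compatible (R S : RawRing 0ℓ 0ℓ)
                  (_∼_ : REL (RawRing.Carrier R) (RawRing.Carrier S) 0ℓ) : Set where
  private
    module R = RawRing R
    module S = RawRing S
  field
    0#-∼  : R.0# ∼ S.0#
    1#-∼  : R.1# ∼ S.1#
    +-∼   : ∀ {x x′ y y′} → x ∼ x′ → y ∼ y′ → (x R.+ y) ∼ (x′ S.+ y′)
    *-∼   : ∀ {x x′ y y′} → x ∼ x′ → y ∼ y′ → (x R.* y) ∼ (x′ S.* y′)
    neg-∼ : ∀ {x x′} → x ∼ x′ → (R.- x) ∼ (S.- x′)

module Lift {R S : RawRing 0ℓ 0ℓ} {_∼_ : REL (RawRing.Carrier R) (RawRing.Carrier S) 0ℓ}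
            (compatible : Compatible R S _∼_) where
  open Compatible compatible
  private
    module R = RawRing R
    module S = RawRing S
    module R[ζ] = Cyclotomic R
    module S[ζ] = Cyclotomic S

  infix 4 _≋_
  _≋_ : R[ζ].Elt → S[ζ].Elt → Set
  _≋_ = Pointwise _∼_

  ⟦⟧⁺ : ∀ {x x′} → x ∼ x′ → R[ζ].⟦ x ⟧ ≋ S[ζ].⟦ x′ ⟧
  ⟦⟧⁺ p = p ∷ replicate⁺ 11 0#-∼

  ⊕⁺ : ∀ {u u′ v v′} → u ≋ u′ → v ≋ v′ → u R[ζ].⊕ v ≋ u′ S[ζ].⊕ v′
  ⊕⁺ = zipWith⁺ +-∼

  ⊖⁺ : ∀ {u u′ v v′} → u ≋ u′ → v ≋ v′ → u R[ζ].⊖ v ≋ u′ S[ζ].⊖ v′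
  ⊖⁺ p q = ⊕⁺ p (Pointwise.map⁺ neg-∼ q)

  •⁺ : ∀ {c c′ u u′} → c ∼ c′ → u ≋ u′ → c R[ζ].• u ≋ c′ S[ζ].• u′
  •⁺ p = Pointwise.map⁺ (*-∼ p)

  ζ¹²-coords⁺ : R[ζ].ζ¹²-coords ≋ S[ζ].ζ¹²-coords
  ζ¹²-coords⁺ =
    m1 ∷ 1#-∼ ∷ 0#-∼ ∷ m1 ∷ 1#-∼ ∷ 0#-∼ ∷ m1 ∷ 0#-∼ ∷ 1#-∼ ∷ m1 ∷ 0#-∼ ∷ 1#-∼ ∷ []
    where
    m1 : (R.- R.1#) ∼ (S.- S.1#)
    m1 = neg-∼ 1#-∼

  timesζ⁺ : ∀ {u u′} → u ≋ u′ → R[ζ].timesζ u ≋ S[ζ].timesζ u′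
  timesζ⁺ p = ⊕⁺ (0#-∼ ∷ init⁺ p) (•⁺ (last⁺ p) ζ¹²-coords⁺)

  mulBy⁺ : ∀ {m} {a : Vec R.Carrier m} {a′ : Vec S.Carrier m} {v v′} →
           Pointwise _∼_ a a′ → v ≋ v′ → R[ζ].mulBy a v ≋ S[ζ].mulBy a′ v′
  mulBy⁺ []       q = ⟦⟧⁺ 0#-∼
  mulBy⁺ (p ∷ ps) q = ⊕⁺ (•⁺ p q) (timesζ⁺ (mulBy⁺ ps q))

  ⊛⁺ : ∀ {u u′ v v′} → u ≋ u′ → v ≋ v′ → u R[ζ].⊛ v ≋ u′ S[ζ].⊛ v′
  ⊛⁺ = mulBy⁺

module ℤ[ζ] = Cyclotomic ℤ.+-*-rawRing
module ℚ[ζ] = Cyclotomic ℚ.+-*-rawRing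
open ℤ[ζ]

/1≡mkℚ : ∀ z → z / 1 ≡ mkℚ z 0 (Coprime.sym (Coprime.1-coprimeTo ℤ.∣ z ∣))
/1≡mkℚ z = ℚ.↥p/↧p≡p (mkℚ z 0 _)

/1-homo-+ : ∀ a b → (a ℤ.+ b) / 1 ≡ a / 1 ℚ.+ b / 1
/1-homo-+ a b rewrite /1≡mkℚ a | /1≡mkℚ b | ℤ.*-identityʳ a | ℤ.*-identityʳ b = refl

/1-homo-* : ∀ a b → (a ℤ.* b) / 1 ≡ (a / 1) ℚ.* (b / 1)
/1-homo-* a b rewrite /1≡mkℚ a | /1≡mkℚ b = refl

/1-homo‿- : ∀ a → (ℤ.- a) / 1 ≡ ℚ.- (a / 1)
/1-homo‿- a = trans (/1≡mkℚ (ℤ.- a)) (trans (mkℚ-neg a) (cong ℚ.-_ (sym (/1≡mkℚ a))))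
  where
  mkℚ-neg : ∀ a → mkℚ (ℤ.- a) 0 (Coprime.sym (Coprime.1-coprimeTo ℤ.∣ ℤ.- a ∣))
                 ≡ ℚ.- mkℚ a 0 (Coprime.sym (Coprime.1-coprimeTo ℤ.∣ a ∣))
  mkℚ-neg (+ zero) = refl
  mkℚ-neg +[1+ n ] = refl
  mkℚ-neg -[1+ n ] = refl

+/1-homo-* : ∀ a b → + (a ℕ.* b) / 1 ≡ (+ a / 1) ℚ.* (+ b / 1)
+/1-homo-* a b = trans (cong (_/ 1) (ℤ.pos-* a b)) (/1-homo-* (+ a) (+ b))

_↦_ : ℤ → ℚ → Set
z ↦ q = z / 1 ≡ q

↦-compatible : Compatible ℤ.+-*-rawRing ℚ.+-*-rawRing _↦_
↦-compatible = record
  { 0#-∼  = refl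
  ; 1#-∼  = refl
  ; +-∼   = λ {x} {_} {y} p q → trans (/1-homo-+ x y) (cong₂ ℚ._+_ p q)
  ; *-∼   = λ {x} {_} {y} p q → trans (/1-homo-* x y) (cong₂ ℚ._*_ p q)
  ; neg-∼ = λ {x} p → trans (/1-homo‿- x) (cong ℚ.-_ p)
  }

module Embedding = Lift ↦-compatible

toK-↦ : ∀ {n} (u : Vec ℤ n) → Pointwise _↦_ u (map (_/ 1) u)
toK-↦ []      = []
toK-↦ (x ∷ u) = refl ∷ toK-↦ u

↦⇒toK : ∀ {n} {u : Vec ℤ n} {v} → Pointwise _↦_ u v → map (_/ 1) u ≡ v
↦⇒toK []       = refl
↦⇒toK (p ∷ ps) = cong₂ _∷_ p (↦⇒toK ps)

toK-⊕ : ∀ u v → toK (u ⊕ v) ≡ toK u +K toK v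
toK-⊕ u v = ↦⇒toK (Embedding.⊕⁺ (toK-↦ u) (toK-↦ v))

toK-⊖ : ∀ u v → toK (u ⊖ v) ≡ toK u -K toK v
toK-⊖ u v = ↦⇒toK (Embedding.⊖⁺ (toK-↦ u) (toK-↦ v))

toK-• : ∀ c u → toK (c • u) ≡ (c / 1) · toK u
toK-• c u = ↦⇒toK (Embedding.•⁺ {c} refl (toK-↦ u))

toK-⊛ : ∀ u v → toK (u ⊛ v) ≡ toK u *K toK v
toK-⊛ u v = ↦⇒toK (Embedding.⊛⁺ (toK-↦ u) (toK-↦ v))

toK-^ : ∀ u n → toK (u ^ n) ≡ toK u ^K n
toK-^ u zero    = refl
toK-^ u (suc n) = trans (toK-⊛ u (u ^ n)) (cong (toK u *K_) (toK-^ u n))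

infix 4 _≡_mod_
_≡_mod_ : ℤ → ℤ → ℤ → Set
x ≡ y mod n = n ∣ x ℤ.- y

mod-refl : ∀ {n} x → x ≡ x mod n
mod-refl {n} x = divides (+ 0) (trans (ℤ.+-inverseʳ x) (sym (ℤ.*-zeroˡ n)))

mod-trans : ∀ {n x y z} → x ≡ y mod n → y ≡ z mod n → x ≡ z mod n
mod-trans {x = x} {y} {z} p q = subst (_ ∣_) (telescope x y z) (∣m∣n⇒∣m+n p q)
  where
  telescope : ∀ x y z → (x ℤ.- y) ℤ.+ (y ℤ.- z) ≡ x ℤ.- z
  telescope = solve-∀

mod-compatible : ∀ n → Compatible ℤ.+-*-rawRing ℤ.+-*-rawRing (_≡_mod n)
mod-compatible n = record
  { 0#-∼  = mod-refl (+ 0)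
  ; 1#-∼  = mod-refl (+ 1)
  ; +-∼   = λ {x} {x′} {y} {y′} p q → subst (_ ∣_) (sum x x′ y y′) (∣m∣n⇒∣m+n p q)
  ; *-∼   = λ {x} {x′} {y} {y′} p q → subst (_ ∣_) (product x x′ y y′)
                                            (∣m∣n⇒∣m+n (∣n⇒∣m*n x q) (∣m⇒∣m*n y′ p))
  ; neg-∼ = λ {x} {x′} p → subst (_ ∣_) (negation x x′) (∣m⇒∣-m p)
  }
  where
  sum : ∀ x x′ y y′ → (x ℤ.- x′) ℤ.+ (y ℤ.- y′) ≡ (x ℤ.+ y) ℤ.- (x′ ℤ.+ y′)
  sum = solve-∀
  product : ∀ x x′ y y′ → x ℤ.* (y ℤ.- y′) ℤ.+ (x ℤ.- x′) ℤ.* y′ ≡ x ℤ.* y ℤ.- x′ ℤ.* y′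
  product = solve-∀
  negation : ∀ x x′ → ℤ.- (x ℤ.- x′) ≡ (ℤ.- x) ℤ.- (ℤ.- x′)
  negation = solve-∀

pow-≡±1 : ∀ {n} k → + k ≡ -1ℤ mod n →
          ∀ m → + (k ℕ.^ m) ≡ + 1 mod n ⊎ + (k ℕ.^ m) ≡ -1ℤ mod n
pow-≡±1     k k≡-1 zero    = inj₁ (mod-refl (+ 1))
pow-≡±1 {n} k k≡-1 (suc m) =
  Sum.swap (Sum.map (times-k {+ 1}) (times-k { -1ℤ}) (pow-≡±1 k k≡-1 m))
  where
  times-k : ∀ {y} → + (k ℕ.^ m) ≡ y mod n → + (k ℕ.* k ℕ.^ m) ≡ -1ℤ ℤ.* y mod n
  times-k {y} p = subst (λ x → x ≡ -1ℤ ℤ.* y mod n) (sym (ℤ.pos-* k (k ℕ.^ m)))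
                        (Compatible.*-∼ (mod-compatible n) {+ k} { -1ℤ} {+ (k ℕ.^ m)} k≡-1 p)

module Congruence (n : ℤ) = Lift (mod-compatible n)

infix 4 _≋_mod_ _≋?_mod_
_≋_mod_ : Elt → Elt → ℤ → Set
u ≋ v mod n = Pointwise (_≡_mod n) u v

_≋?_mod_ : ∀ u v n → Dec (u ≋ v mod n)
u ≋? v mod n = Pointwise.decidable (λ x y → n ∣? (x ℤ.- y)) u v

≋-refl : ∀ {n} u → u ≋ u mod n
≋-refl u = Pointwise.refl (λ {x} → mod-refl x)

≋-trans : ∀ {n u v w} → u ≋ v mod n → v ≋ w mod n → u ≋ w mod n
≋-trans = Pointwise.trans (λ {x} {y} {z} → mod-trans {x = x} {y} {z})

≋⇒multiple : ∀ {n u v} → u ≋ v mod n → ∃[ d ] u ⊖ v ≡ n • d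
≋⇒multiple {n} = multiple
  where
  multiple : ∀ {m} {u v : Vec ℤ m} → Pointwise (_≡_mod n) u v →
             ∃[ d ] zipWith ℤ._+_ u (map ℤ.-_ v) ≡ map (n ℤ.*_) d
  multiple []                  = [] , refl
  multiple (divides q eq ∷ ps) =
    let d , eqs = multiple ps in q ∷ d , cong₂ _∷_ (trans eq (ℤ.*-comm q n)) eqs

^-period-2 : ∀ {n} u → u ^ 2 ≋ 𝟙 mod n → ∀ i → u ^ (2 ℕ.+ i) ≋ u ^ i mod n
^-period-2     u u²≡1 zero    = u²≡1
^-period-2 {n} u u²≡1 (suc i) = Congruence.⊛⁺ n (≋-refl u) (^-period-2 u u²≡1 i)

power-sum-≋ : ∀ {n} u v {w} → u ^ 2 ≋ 𝟙 mod n → v ^ 2 ≋ 𝟙 mod n →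
              𝟙 ⊕ 𝟙 ≋ w mod n → u ^ 1 ⊕ v ^ 1 ≋ w mod n →
              ∀ i → u ^ i ⊕ v ^ i ≋ w mod n
power-sum-≋     u v u²≡1 v²≡1 even odd zero          = even
power-sum-≋     u v u²≡1 v²≡1 even odd (suc zero)    = odd
power-sum-≋ {n} u v u²≡1 v²≡1 even odd (suc (suc i)) =
  ≋-trans (Congruence.⊕⁺ n (^-period-2 u u²≡1 i) (^-period-2 v v²≡1 i))
          (power-sum-≋ u v u²≡1 v²≡1 even odd i)

7^-•-≡2 : ∀ m {w} → w ≋ ⟦ + 2 ⟧ mod + 4 → + (7 ℕ.^ m) • w ≋ ⟦ + 2 ⟧ mod + 4
7^-•-≡2 m w≡2 with pow-≡±1 7 (divides (+ 2) refl) m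
... | inj₁ 7^m≡1  = ≋-trans (Congruence.•⁺ (+ 4) {+ (7 ℕ.^ m)} {+ 1} 7^m≡1 w≡2)
                            (from-yes (+ 1 • ⟦ + 2 ⟧ ≋? ⟦ + 2 ⟧ mod + 4))
... | inj₂ 7^m≡-1 = ≋-trans (Congruence.•⁺ (+ 4) {+ (7 ℕ.^ m)} { -1ℤ} 7^m≡-1 w≡2)
                            (from-yes (-1ℤ • ⟦ + 2 ⟧ ≋? ⟦ + 2 ⟧ mod + 4))

open ℤ[ζ].Laws ℤ.+-*-isCommutativeRing using (⟦⟧-⊛)

-- The implicit arguments of cong are supplied because inferring them makes Agda unfold
-- _⊛_ with a concrete left factor, which takes exponential time.
≡2-mod-4⇒Cong2mod4 : ∀ {w} → w ≋ ⟦ + 2 ⟧ mod + 4 → Cong2mod4 (toK w)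
≡2-mod-4⇒Cong2mod4 {w} p = let d , w-2≡4d = ≋⇒multiple p in d , (begin
  toK w -K ι (+ 2 / 1)  ≡⟨⟩
  toK w -K toK ⟦ + 2 ⟧  ≡⟨ toK-⊖ w ⟦ + 2 ⟧ ⟨
  toK (w ⊖ ⟦ + 2 ⟧)     ≡⟨ cong toK w-2≡4d ⟩
  toK (+ 4 • d)         ≡⟨ cong toK {⟦ + 4 ⟧ ⊛ d} {+ 4 • d} (⟦⟧-⊛ (+ 4) d) ⟨
  toK (⟦ + 4 ⟧ ⊛ d)     ≡⟨ toK-⊛ ⟦ + 4 ⟧ d ⟩
  toK ⟦ + 4 ⟧ *K toK d  ≡⟨ cong (_*K toK d) {toK ⟦ + 4 ⟧} {ι (+ 4 / 1)} refl ⟩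
  ι (+ 4 / 1) *K toK d  ∎)
  where open ≡-Reasoning

open ℚ[ζ].Laws ℚ.+-*-isCommutativeRing using (•-assoc; •-identityˡ; •-distribˡ-⊕; •-⊛-•)

·-^K : ∀ k n u → (+ (k ℕ.^ n) / 1) · u ^K n ≡ ((+ k / 1) · u) ^K n
·-^K k zero    u = •-identityˡ 1K
·-^K k (suc n) u = begin
  (+ (k ℕ.* k ℕ.^ n) / 1) · (u *K u ^K n)
    ≡⟨ cong (_· (u *K u ^K n)) (+/1-homo-* k (k ℕ.^ n)) ⟩
  ((+ k / 1) ℚ.* (+ (k ℕ.^ n) / 1)) · (u *K u ^K n)
    ≡⟨ •-⊛-• (+ k / 1) (+ (k ℕ.^ n) / 1) u (u ^K n) ⟨
  ((+ k / 1) · u) *K ((+ (k ℕ.^ n) / 1) · u ^K n)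
    ≡⟨ cong (((+ k / 1) · u) *K_) (·-^K k n u) ⟩
  ((+ k / 1) · u) *K ((+ k / 1) · u) ^K n
    ∎
  where open ≡-Reasoning

7^-homo-+ : ∀ m i → 7^ (m ℕ.+ i) ≡ 7^ m ℚ.* 7^ i
7^-homo-+ m i =
  trans (cong (λ k → + k / 1) (ℕ.^-distribˡ-+-* 7 m i)) (+/1-homo-* (7 ℕ.^ m) (7 ℕ.^ i))

-- The coordinates of 7x₁ and 7x₁⁻¹.
a₁ b₁ : Elt
a₁ = + 1 ∷ -[1+ 5 ] ∷ + 4 ∷ + 0 ∷ -[1+ 5 ] ∷ + 0 ∷ + 0 ∷ -[1+ 1 ] ∷ -[1+ 1 ] ∷ + 6 ∷ + 0 ∷ -[1+ 1 ] ∷ []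
b₁ = -[1+ 2 ] ∷ + 2 ∷ + 4 ∷ + 0 ∷ + 2 ∷ + 0 ∷ + 0 ∷ -[1+ 1 ] ∷ + 6 ∷ -[1+ 1 ] ∷ + 0 ∷ + 6 ∷ []

x₁≡a₁/7 : x₁ ≡ (+ 1 / 7) · toK a₁
x₁≡a₁/7 = from-yes (≡-dec ℚ._≟_ x₁ ((+ 1 / 7) · toK a₁))

-- Evaluating inv at a₁/7 instead of at x₁ spares a second evaluation of x₁.
7·inv[a₁/7]≡b₁ : (+ 7 / 1) · inv ((+ 1 / 7) · toK a₁) ≡ toK b₁
7·inv[a₁/7]≡b₁ = from-yes (≡-dec ℚ._≟_ ((+ 7 / 1) · inv ((+ 1 / 7) · toK a₁)) (toK b₁))

7x₁≡a₁ : (+ 7 / 1) · x₁ ≡ toK a₁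
7x₁≡a₁ = trans (cong ((+ 7 / 1) ·_) {x₁} {(+ 1 / 7) · toK a₁} x₁≡a₁/7) (7·[u/7]≡u (toK a₁))
  where
  7·[u/7]≡u : ∀ u → (+ 7 / 1) · ((+ 1 / 7) · u) ≡ u
  7·[u/7]≡u u = trans (•-assoc (+ 7 / 1) (+ 1 / 7) u) (•-identityˡ u)

7x₁⁻¹≡b₁ : (+ 7 / 1) · inv x₁ ≡ toK b₁
7x₁⁻¹≡b₁ =
  trans (cong (λ w → (+ 7 / 1) · inv w) {x₁} {(+ 1 / 7) · toK a₁} x₁≡a₁/7) 7·inv[a₁/7]≡b₁

power-sum : ℕ → Elt
power-sum i = a₁ ^ i ⊕ b₁ ^ i

power-sum≡2 : ∀ i → power-sum i ≋ ⟦ + 2 ⟧ mod + 4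
power-sum≡2 = power-sum-≋ a₁ b₁
  (from-yes (a₁ ^ 2 ≋? 𝟙 mod + 4))
  (from-yes (b₁ ^ 2 ≋? 𝟙 mod + 4))
  (from-yes (𝟙 ⊕ 𝟙 ≋? ⟦ + 2 ⟧ mod + 4))
  (from-yes (a₁ ^ 1 ⊕ b₁ ^ 1 ≋? ⟦ + 2 ⟧ mod + 4))

7^·s≡power-sum : ∀ m i → 7^ (m ℕ.+ i) · s i ≡ toK (+ (7 ℕ.^ m) • power-sum i)
7^·s≡power-sum m i = begin
  7^ (m ℕ.+ i) · s i
    ≡⟨ cong (_· s i) (7^-homo-+ m i) ⟩
  (7^ m ℚ.* 7^ i) · s i
    ≡⟨ •-assoc (7^ m) (7^ i) (s i) ⟨
  7^ m · (7^ i · (x₁ ^K i +K inv x₁ ^K i))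
    ≡⟨ cong (7^ m ·_) (•-distribˡ-⊕ (7^ i) (x₁ ^K i) (inv x₁ ^K i)) ⟩
  7^ m · (7^ i · x₁ ^K i +K 7^ i · inv x₁ ^K i)
    ≡⟨ cong₂ (λ a b → 7^ m · (a +K b)) (·-^K 7 i x₁) (·-^K 7 i (inv x₁)) ⟩
  7^ m · (((+ 7 / 1) · x₁) ^K i +K ((+ 7 / 1) · inv x₁) ^K i)
    ≡⟨ cong₂ (λ a b → 7^ m · (a ^K i +K b ^K i)) 7x₁≡a₁ 7x₁⁻¹≡b₁ ⟩
  7^ m · (toK a₁ ^K i +K toK b₁ ^K i)
    ≡⟨ cong (7^ m ·_) (cong₂ _+K_ (toK-^ a₁ i) (toK-^ b₁ i)) ⟨
  7^ m · (toK (a₁ ^ i) +K toK (b₁ ^ i))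
    ≡⟨ cong (7^ m ·_) (toK-⊕ (a₁ ^ i) (b₁ ^ i)) ⟨
  7^ m · toK (power-sum i)
    ≡⟨ toK-• (+ (7 ℕ.^ m)) (power-sum i) ⟨
  toK (+ (7 ℕ.^ m) • power-sum i)
    ∎
  where open ≡-Reasoning

lemma18 : (i : ℕ) → i ≥ 1 →
    ∃[ c ] (c ≥ 1
    × InOK (7^ c · s i) × Cong2mod4 (7^ c · s i)
    × ((n : ℕ) → n > c → InOK (7^ n · s i) × Cong2mod4 (7^ n · s i)))
lemma18 i i≥1 =
  let in-OK , ≡2-mod-4 = integral 0
  in i , i≥1 , in-OK , ≡2-mod-4 ,
     λ n n>i → subst P (ℕ.m∸n+n≡m (ℕ.<⇒≤ n>i)) (integral (n ℕ.∸ i))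
  where
  P : ℕ → Set
  P n = InOK (7^ n · s i) × Cong2mod4 (7^ n · s i)
  integral : ∀ m → P (m ℕ.+ i)
  integral m = subst (λ w → InOK w × Cong2mod4 w) (sym (7^·s≡power-sum m i))
    ((+ (7 ℕ.^ m) • power-sum i , refl) , ≡2-mod-4⇒Cong2mod4 (7^-•-≡2 m (power-sum≡2 i)))
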